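{- For all $n\ge 3$, $\mathrm{r}_n(2413)=2\,\mathrm{r}_{n-1}(2413)+2\,\mathrm{r}_{n-2}(2413)$.
   Context: $\mathcal{S}_n$ is the set of permutations of $[n]$, $\pi^r$ the reversal of $\pi$. A word $w$ contains $\rho\in\mathcal{S}_k$ if some subsequence $w_{i_1}\cdots w_{i_k}$ ($i_1<\cdots<i_k$) satisfies $w_{i_a}\le w_{i_b}$ iff $\rho_a\le\rho_b$; otherwise it avoids $\rho$. $\mathcal{R}_n=\{\pi\pi^r:\pi\in\mathcal{S}_n\}$ (concatenation of $\pi$ with its reversal), and $\mathrm{r}_n(\rho)$ is the number of members of $\mathcal{R}_n$ avoiding $\rho$; here $\mathrm{r}_1=1$, $\mathrm{r}_2=2$. -}

module Defs where

open import Data.Nat using (ℕ; zero; suc; _≤ᵇ_)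
open import Data.Bool using (Bool; true; false; _∧_; not)
open import Data.List using (List; []; _∷_; _++_; reverse; map; concatMap; length; filter; upTo; applyUpTo; zip)
open import Data.Bool.ListAction using (any; all)
open import Data.Product using (_×_; _,_)

-- Words are lists of natural numbers; a permutation of [n] = {1,…,n}
-- is a word of length n using each of 1,…,n exactly once (one-line notation).

words : ℕ → ℕ → List (List ℕ)
words n zero    = [] ∷ []
words n (suc k) = concatMap (λ a → map (a ∷_) (words n k)) (applyUpTo suc n)

filterᵇ : {A : Set} → (A → Bool) → List A → List A
filterᵇ p []       = []
filterᵇ p (x ∷ xs) with p x
... | true  = x ∷ filterᵇ p xs
... | false = filterᵇ p xs

_==_ : ℕ → ℕ → Bool
zero  == zero  = true
zero  == suc _ = false
suc _ == zero  = false
suc m == suc n = m == n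

distinct : List ℕ → Bool
distinct []       = true
distinct (x ∷ xs) = all (λ y → not (x == y)) xs ∧ distinct xs

S : ℕ → List (List ℕ)
S n = filterᵇ distinct (words n n)

subseqs : List ℕ → List (List ℕ)
subseqs []       = [] ∷ []
subseqs (x ∷ xs) = map (x ∷_) (subseqs xs) ++ subseqs xs

_iffᵇ_ : Bool → Bool → Bool
true  iffᵇ b = b
false iffᵇ b = not b

sameLength : List ℕ → List ℕ → Bool
sameLength []       []       = true
sameLength (_ ∷ xs) (_ ∷ ys) = sameLength xs ys
sameLength _        _        = false

orderIso : List ℕ → List ℕ → Bool
orderIso u ρ = sameLength u ρ ∧
  all (λ { ((ua , ρa) , (ub , ρb)) → (ua ≤ᵇ ub) iffᵇ (ρa ≤ᵇ ρb) })
      (pairsZ (zip u ρ))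
  where
  pairsZ : List (ℕ × ℕ) → List ((ℕ × ℕ) × (ℕ × ℕ))
  pairsZ ps = concatMap (λ p → map (λ q → p , q) ps) ps

contains : List ℕ → List ℕ → Bool
contains w ρ = any (λ u → orderIso u ρ) (subseqs w)

avoids : List ℕ → List ℕ → Bool
avoids w ρ = not (contains w ρ)

R : ℕ → List (List ℕ)
R n = map (λ π → π ++ reverse π) (S n)

r : ℕ → List ℕ → ℕ
r n ρ = length (filterᵇ (λ w → avoids w ρ) (R n))

p2413 : List ℕ
p2413 = 2 ∷ 4 ∷ 1 ∷ 3 ∷ []

module Submission where

open import Defs
open import Data.Nat using (ℕ; zero; suc; _+_; _*_; _≤_; _<_; _∸_; _≤ᵇ_; z≤n; s≤s; z<s; s<s⁻¹)
open import Data.Nat.Properties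
  using ( _≟_; ≤ᵇ-reflects-≤; ≤-refl; ≤-reflexive; ≤-trans; <-trans; <⇒≤; ≤-<-trans; <⇒≱; ≰⇒>; <-cmp
        ; m≤n⇒m≤1+n; m<n⇒m≤1+n; n≤1+n; n<1+n; <⇒≢; >⇒≢; +-identityʳ; suc-injective )
open import Data.Nat.ListAction using (sum)
open import Data.Nat.ListAction.Properties using (sum-++)
open import Data.Nat.Tactic.RingSolver using (solve-∀)
open import Data.Bool using (Bool; true; false; _∧_; not; T)
open import Data.Bool.Properties using (T-∧; T-≡)
open import Data.Bool.ListAction using (and)
open import Data.List
  using (List; []; _∷_; _++_; [_]; reverse; map; zip; concatMap; applyUpTo; length; filter)
open import Data.List.Properties
  using ( length-applyUpTo; applyUpTo-∷ʳ; map-applyUpTo; map-cong; map-∘; map-++; filter-notAll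
        ; unfold-reverse; reverse-map; ++-assoc; ∷ʳ-injective )
open import Data.List.Membership.Propositional using (_∈_; _∉_; find; lose)
open import Data.List.Membership.DecPropositional _≟_ using (_∈?_)
open import Data.List.Membership.Propositional.Properties
  using ( ∈-++⁻; ∈-++⁺ˡ; ∈-++⁺ʳ; ∈-map⁺; ∈-map⁻; ∈-filter⁺; ∈-applyUpTo⁺; ∈-applyUpTo⁻
        ; ∈-concatMap⁺; ∈-concatMap⁻ )
open import Data.List.Relation.Unary.Any using (here; there)
import Data.List.Relation.Unary.Any as Any
import Data.List.Relation.Unary.Any.Properties as Any
open import Data.List.Relation.Unary.All as All using (All; []; _∷_)
import Data.List.Relation.Unary.All.Properties as All
open import Data.List.Relation.Binary.Sublist.Propositional
  using (_⊆_; []; _∷_; _∷ʳ_; ⊆-trans; ⊆-refl; from∈)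
open import Data.List.Relation.Binary.Sublist.Propositional.Properties
  using (++⁺; ++⁺ʳ; All-resp-⊆; map⁺; reverse⁺)
open import Data.Product using (∃; _×_; _,_; proj₁; proj₂)
open import Data.Sum using (_⊎_; inj₁; inj₂)
open import Data.Empty using (⊥-elim)
open import Function.Base using (_∘_)
open import Function.Bundles using (_⇔_; mk⇔; Equivalence)
open import Relation.Nullary using (¬_; yes; no)
open import Relation.Nullary.Decidable using (¬?)
open import Relation.Nullary.Reflects using (Reflects; ofʸ; ofⁿ)
open import Relation.Binary.Definitions using (tri<; tri≈; tri>)
open import Relation.Binary.PropositionalEquality
  using (_≡_; _≢_; refl; sym; trans; cong; cong₂; subst; module ≡-Reasoning)

-- Split the permutations π of [n] counted by rₙ according to their first letter a, which is
-- also the last letter of ππʳ; note that any two letters of π occur in ππʳ in both orders.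
-- For a = 1 or a = n the two outer letters can take part in no occurrence of 2413, so these
-- π are counted by rₙ₋₁. For a = 2 the second letter must be 1, since otherwise two larger
-- letters and the letter 1 force an occurrence; the outer letters 2 1 … 1 2 can then be
-- removed, leaving rₙ₋₂ choices, and symmetrically a = n − 1 must be followed by n.
-- Finally, for 3 ≤ a ≤ n − 2 the letters 1, 2, n − 1, n after a always produce 2413.

private
  variable
    A B : Set

-- Occurrences of 2413

record Contains2413 (w : List ℕ) : Set where
  constructor occurrence
  field
    {a b c d} : ℕ
    embedding : a ∷ b ∷ c ∷ d ∷ [] ⊆ w
    c<a : c < a
    a<d : a < d
    d<b : d < b

Contains2413-⊆ : ∀ {v w} → v ⊆ w → Contains2413 v → Contains2413 w
Contains2413-⊆ v⊆w (occurrence s c<a a<d d<b) = occurrence (⊆-trans s v⊆w) c<a a<d d<b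

⊆-map⁻ : ∀ (f : A → B) {u} w → u ⊆ map f w → ∃ λ v → u ≡ map f v × v ⊆ w
⊆-map⁻ f []      []         = [] , refl , []
⊆-map⁻ f (x ∷ w) (_ ∷ʳ s)   with v , refl , v⊆w ← ⊆-map⁻ f w s = v , refl , x ∷ʳ v⊆w
⊆-map⁻ f (x ∷ w) (refl ∷ s) with v , refl , v⊆w ← ⊆-map⁻ f w s = x ∷ v , refl , refl ∷ v⊆w

module _ {f : ℕ → ℕ} where

  Contains2413-map⁺ : (∀ {m n} → m < n → f m < f n) → ∀ {w} → Contains2413 w → Contains2413 (map f w)
  Contains2413-map⁺ mono (occurrence s c<a a<d d<b) =
    occurrence (map⁺ f s) (mono c<a) (mono a<d) (mono d<b)

  Contains2413-map⁻ : (∀ {m n} → f m < f n → m < n) → ∀ w → Contains2413 (map f w) → Contains2413 w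
  Contains2413-map⁻ reflect w (occurrence s c<a a<d d<b)
    with a ∷ b ∷ c ∷ d ∷ [] , refl , s′ ← ⊆-map⁻ f w s =
    occurrence s′ (reflect c<a) (reflect a<d) (reflect d<b)

∈-subseqs⁻ : ∀ {u} w → u ∈ subseqs w → u ⊆ w
∈-subseqs⁻ []      (here refl) = []
∈-subseqs⁻ (x ∷ w) u∈ with ∈-++⁻ (map (x ∷_) (subseqs w)) u∈
... | inj₁ u∈′ with _ , v∈ , refl ← ∈-map⁻ (x ∷_) u∈′ = refl ∷ ∈-subseqs⁻ w v∈
... | inj₂ u∈′ = x ∷ʳ ∈-subseqs⁻ w u∈′

∈-subseqs⁺ : ∀ {u w} → u ⊆ w → u ∈ subseqs w
∈-subseqs⁺ []           = here refl
∈-subseqs⁺ (x ∷ʳ u⊆w)   = ∈-++⁺ʳ _ (∈-subseqs⁺ u⊆w)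
∈-subseqs⁺ (refl ∷ u⊆w) = ∈-++⁺ˡ (∈-map⁺ _ (∈-subseqs⁺ u⊆w))

-- orderIso compares all pairs through an anonymous pattern lambda; comparable and pairs
-- restate it definitionally, so that lemmas about all can be instantiated.
comparable : (ℕ × ℕ) × (ℕ × ℕ) → Bool
comparable ((x , i) , (y , j)) = (x ≤ᵇ y) iffᵇ (i ≤ᵇ j)

pairs : List (ℕ × ℕ) → List ((ℕ × ℕ) × (ℕ × ℕ))
pairs ps = concatMap (λ p → map (p ,_) ps) ps

iffᵇ-true⇔≤ : ∀ m n → T ((m ≤ᵇ n) iffᵇ true) ⇔ m ≤ n
iffᵇ-true⇔≤ m n with m ≤ᵇ n | ≤ᵇ-reflects-≤ m n
... | true  | ofʸ m≤n = mk⇔ (λ _ → m≤n) _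
... | false | ofⁿ m≰n = mk⇔ (λ ()) m≰n

iffᵇ-false⇔> : ∀ m n → T ((m ≤ᵇ n) iffᵇ false) ⇔ n < m
iffᵇ-false⇔> m n with m ≤ᵇ n | ≤ᵇ-reflects-≤ m n
... | true  | ofʸ m≤n = mk⇔ (λ ()) (λ n<m → <⇒≱ n<m m≤n)
... | false | ofⁿ m≰n = mk⇔ (λ _ → ≰⇒> m≰n) _

module _ {a b c d : ℕ} where

  open Equivalence

  orderIso-2413⁻ : T (orderIso (a ∷ b ∷ c ∷ d ∷ []) p2413) → c < a × a < d × d < b
  orderIso-2413⁻ iso with All.all⁺ comparable (pairs (zip (a ∷ b ∷ c ∷ d ∷ []) p2413)) iso
  ... | _ ∷ _ ∷ a≰c ∷ _ ∷ _ ∷ _ ∷ _ ∷ b≰d ∷ _ ∷ _ ∷ _ ∷ _ ∷ d≰a ∷ _ =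
    to (iffᵇ-false⇔> a c) a≰c , to (iffᵇ-false⇔> d a) d≰a , to (iffᵇ-false⇔> b d) b≰d

  orderIso-2413⁺ : c < a → a < d → d < b → T (orderIso (a ∷ b ∷ c ∷ d ∷ []) p2413)
  orderIso-2413⁺ c<a a<d d<b = All.all⁻ comparable {xs = pairs (zip (a ∷ b ∷ c ∷ d ∷ []) p2413)}
    ( ≤ (≤-refl {a}) ∷ ≤ (<⇒≤ a<b)    ∷ > c<a          ∷ ≤ (<⇒≤ a<d)
    ∷ > a<b          ∷ ≤ (≤-refl {b}) ∷ > c<b          ∷ > d<b
    ∷ ≤ (<⇒≤ c<a)    ∷ ≤ (<⇒≤ c<b)    ∷ ≤ (≤-refl {c}) ∷ ≤ (<⇒≤ c<d)
    ∷ > a<d          ∷ ≤ (<⇒≤ d<b)    ∷ > c<d          ∷ ≤ (≤-refl {d}) ∷ [])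
    where
    ≤ : ∀ {m n} → m ≤ n → T ((m ≤ᵇ n) iffᵇ true)
    ≤ {m} {n} = from (iffᵇ-true⇔≤ m n)
    > : ∀ {m n} → n < m → T ((m ≤ᵇ n) iffᵇ false)
    > {m} {n} = from (iffᵇ-false⇔> m n)
    a<b = <-trans a<d d<b
    c<d = <-trans c<a a<d
    c<b = <-trans c<d d<b

contains-2413⇔ : ∀ w → T (contains w p2413) ⇔ Contains2413 w
contains-2413⇔ w = mk⇔ to from
  where
  to : T (contains w p2413) → Contains2413 w
  to h with find (Any.any⁻ (λ u → orderIso u p2413) (subseqs w) h)
  ... | a ∷ b ∷ c ∷ d ∷ [] , u∈ , iso with c<a , a<d , d<b ← orderIso-2413⁻ iso =
    occurrence (∈-subseqs⁻ w u∈) c<a a<d d<b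
  ... | []                    , _ , ()
  ... | _ ∷ []                , _ , ()
  ... | _ ∷ _ ∷ []            , _ , ()
  ... | _ ∷ _ ∷ _ ∷ []        , _ , ()
  ... | _ ∷ _ ∷ _ ∷ _ ∷ _ ∷ _ , _ , ()
  from : Contains2413 w → T (contains w p2413)
  from (occurrence s c<a a<d d<b) =
    Any.any⁺ (λ u → orderIso u p2413) (lose (∈-subseqs⁺ s) (orderIso-2413⁺ c<a a<d d<b))

T-⇔⇒≡ : ∀ {x y} → T x ⇔ T y → x ≡ y
T-⇔⇒≡ {false} {false} _   = refl
T-⇔⇒≡ {false} {true}  x⇔y = ⊥-elim (Equivalence.from x⇔y _)
T-⇔⇒≡ {true}  {false} x⇔y = ⊥-elim (Equivalence.to x⇔y _)
T-⇔⇒≡ {true}  {true}  _   = refl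

contains-2413-cong : ∀ {v w} → (Contains2413 v → Contains2413 w) → (Contains2413 w → Contains2413 v) →
                     contains v p2413 ≡ contains w p2413
contains-2413-cong {v} {w} v⇒w w⇒v = T-⇔⇒≡ (mk⇔ (from (contains-2413⇔ w) ∘ v⇒w ∘ to (contains-2413⇔ v))
                                                (from (contains-2413⇔ v) ∘ w⇒v ∘ to (contains-2413⇔ w)))
  where open Equivalence

⊆-snoc⁻ : ∀ {u} (M : List A) x → u ⊆ M ++ [ x ] → u ⊆ M ⊎ ∃ λ v → u ≡ v ++ [ x ] × v ⊆ M
⊆-snoc⁻ []      x (_ ∷ʳ [])   = inj₁ []
⊆-snoc⁻ []      x (refl ∷ []) = inj₂ ([] , refl , [])
⊆-snoc⁻ (y ∷ M) x (_ ∷ʳ s) with ⊆-snoc⁻ M x s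
... | inj₁ s′              = inj₁ (y ∷ʳ s′)
... | inj₂ (v , refl , s′) = inj₂ (v , refl , y ∷ʳ s′)
⊆-snoc⁻ (y ∷ M) x (refl ∷ s) with ⊆-snoc⁻ M x s
... | inj₁ s′              = inj₁ (refl ∷ s′)
... | inj₂ (v , refl , s′) = inj₂ (y ∷ v , refl , refl ∷ s′)

-- In an occurrence c < a < d < b the first letter a has one smaller and two larger letters
-- after it, and the last letter d has two smaller letters and one larger letter before it.
-- So a first or last letter lying below, or above, all other letters (up to one) can be dropped.

module _ {x : ℕ} {M : List ℕ} where

  Contains2413-∷⁻-min : All (x ≤_) M → Contains2413 (x ∷ M) → Contains2413 M
  Contains2413-∷⁻-min _   (occurrence (_ ∷ʳ s) c<a a<d d<b) = occurrence s c<a a<d d<b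
  Contains2413-∷⁻-min x≤M (occurrence (refl ∷ s) c<a _ _)
    with _ ∷ x≤c ∷ _ ← All-resp-⊆ s x≤M = ⊥-elim (<⇒≱ c<a x≤c)

  Contains2413-∷⁻-max : All (_≤ suc x) M → Contains2413 (x ∷ M) → Contains2413 M
  Contains2413-∷⁻-max _     (occurrence (_ ∷ʳ s) c<a a<d d<b) = occurrence s c<a a<d d<b
  Contains2413-∷⁻-max M≤1+x (occurrence (refl ∷ s) _ a<d d<b)
    with b≤1+x ∷ _ ← All-resp-⊆ s M≤1+x = ⊥-elim (<⇒≱ (≤-<-trans a<d d<b) b≤1+x)

  Contains2413-snoc⁻-min : All (λ y → x ≤ suc y) M → Contains2413 (M ++ [ x ]) → Contains2413 M
  Contains2413-snoc⁻-min x≤1+M (occurrence {a} {b} {c} s c<a a<d d<b) with ⊆-snoc⁻ M x s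
  ... | inj₁ s′ = occurrence s′ c<a a<d d<b
  ... | inj₂ (v , eq , s′) with refl , refl ← ∷ʳ-injective (a ∷ b ∷ c ∷ []) v eq
                           with _ ∷ _ ∷ x≤1+c ∷ [] ← All-resp-⊆ s′ x≤1+M =
    ⊥-elim (<⇒≱ (≤-<-trans c<a a<d) x≤1+c)

  Contains2413-snoc⁻-max : All (_≤ x) M → Contains2413 (M ++ [ x ]) → Contains2413 M
  Contains2413-snoc⁻-max M≤x (occurrence {a} {b} {c} s c<a a<d d<b) with ⊆-snoc⁻ M x s
  ... | inj₁ s′ = occurrence s′ c<a a<d d<b
  ... | inj₂ (v , eq , s′) with refl , refl ← ∷ʳ-injective (a ∷ b ∷ c ∷ []) v eq
                           with _ ∷ b≤x ∷ _ ← All-resp-⊆ s′ M≤x =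
    ⊥-elim (<⇒≱ d<b b≤x)

module _ {x y : ℕ} {M : List ℕ} where

  -- x cannot play the 2 of an occurrence: the only smaller letter, y, comes too early.
  Contains2413-∷∷⁻ : y < x → All (x <_) M → Contains2413 (x ∷ y ∷ M) → Contains2413 (y ∷ M)
  Contains2413-∷∷⁻ _   _   (occurrence (_ ∷ʳ s) c<a a<d d<b) = occurrence s c<a a<d d<b
  Contains2413-∷∷⁻ y<x _   (occurrence (refl ∷ refl ∷ _) _ a<d d<b) =
    ⊥-elim (<⇒≱ (<-trans a<d d<b) (<⇒≤ y<x))
  Contains2413-∷∷⁻ _   x<M (occurrence (refl ∷ _ ∷ʳ s) c<a _ _)
    with _ ∷ x<c ∷ _ ← All-resp-⊆ s x<M = ⊥-elim (<⇒≱ c<a (<⇒≤ x<c))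

  -- x cannot play the 3 of an occurrence: the only larger letter, y, comes too late.
  Contains2413-snoc-snoc⁻ : x < y → All (_< x) M →
                            Contains2413 ((M ++ [ y ]) ++ [ x ]) → Contains2413 (M ++ [ y ])
  Contains2413-snoc-snoc⁻ x<y M<x (occurrence {a} {b} {c} s c<a a<d d<b) with ⊆-snoc⁻ (M ++ [ y ]) x s
  ... | inj₁ s′ = occurrence s′ c<a a<d d<b
  ... | inj₂ (v , eq , s′) with refl , refl ← ∷ʳ-injective (a ∷ b ∷ c ∷ []) v eq
                           with ⊆-snoc⁻ M y s′
  ...   | inj₁ t with _ ∷ b<x ∷ _ ← All-resp-⊆ t M<x = ⊥-elim (<⇒≱ d<b (<⇒≤ b<x))
  ...   | inj₂ (v′ , eq′ , t) with refl , refl ← ∷ʳ-injective (a ∷ b ∷ []) v′ eq′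
                              with a<x ∷ _ ← All-resp-⊆ t M<x =
    ⊥-elim (<⇒≱ (<-trans c<a a<x) (<⇒≤ x<y))

-- Mirror words ππʳ

mirror : List ℕ → List ℕ
mirror π = π ++ reverse π

mirror-∷ : ∀ x τ → mirror (x ∷ τ) ≡ x ∷ (mirror τ ++ [ x ])
mirror-∷ x τ = cong (x ∷_) (begin
  τ ++ reverse (x ∷ τ)       ≡⟨ cong (τ ++_) (unfold-reverse x τ) ⟩
  τ ++ (reverse τ ++ [ x ])  ≡⟨ ++-assoc τ (reverse τ) [ x ] ⟨
  mirror τ ++ [ x ]          ∎)
  where open ≡-Reasoning

mirror-∷∷ : ∀ x y τ → mirror (x ∷ y ∷ τ) ≡ x ∷ y ∷ ((mirror τ ++ [ y ]) ++ [ x ])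
mirror-∷∷ x y τ = trans (mirror-∷ x (y ∷ τ)) (cong (λ w → x ∷ (w ++ [ x ])) (mirror-∷ y τ))

mirror-map : ∀ (f : ℕ → ℕ) π → mirror (map f π) ≡ map f (mirror π)
mirror-map f π = trans (cong (map f π ++_) (sym (reverse-map f π))) (sym (map-++ f π (reverse π)))

All-mirror⁺ : ∀ {P : ℕ → Set} {π} → All P π → All P (mirror π)
All-mirror⁺ pπ = All.++⁺ pπ (All.tabulate (All.lookup pπ ∘ Any.reverse⁻))

mirror-pair : ∀ {x y π} → x ∈ π → y ∈ π → x ∷ y ∷ [] ⊆ mirror π
mirror-pair x∈π y∈π = ++⁺ (from∈ x∈π) (from∈ (Any.reverse⁺ y∈π))

contains-mirror-∷-min : ∀ {x τ} → All (x ≤_) τ →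
                        contains (mirror (x ∷ τ)) p2413 ≡ contains (mirror τ) p2413
contains-mirror-∷-min {x} {τ} x≤τ = trans (cong (λ w → contains w p2413) (mirror-∷ x τ))
  (contains-2413-cong
    (Contains2413-snoc⁻-min (All.map m≤n⇒m≤1+n x≤M) ∘ Contains2413-∷⁻-min (All.∷ʳ⁺ x≤M ≤-refl))
    (Contains2413-⊆ (x ∷ʳ ++⁺ʳ [ x ] ⊆-refl)))
  where
  x≤M : All (x ≤_) (mirror τ)
  x≤M = All-mirror⁺ x≤τ

contains-mirror-∷-max : ∀ {x τ} → All (_≤ x) τ →
                        contains (mirror (x ∷ τ)) p2413 ≡ contains (mirror τ) p2413
contains-mirror-∷-max {x} {τ} τ≤x = trans (cong (λ w → contains w p2413) (mirror-∷ x τ))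
  (contains-2413-cong
    (Contains2413-snoc⁻-max M≤x ∘ Contains2413-∷⁻-max (All.map m≤n⇒m≤1+n (All.∷ʳ⁺ M≤x ≤-refl)))
    (Contains2413-⊆ (x ∷ʳ ++⁺ʳ [ x ] ⊆-refl)))
  where
  M≤x : All (_≤ x) (mirror τ)
  M≤x = All-mirror⁺ τ≤x

contains-mirror-∷∷-min : ∀ {y τ} → All (suc y <_) τ →
                         contains (mirror (suc y ∷ y ∷ τ)) p2413 ≡ contains (mirror τ) p2413
contains-mirror-∷∷-min {y} {τ} x<τ = trans (cong (λ w → contains w p2413) (mirror-∷∷ x y τ))
  (contains-2413-cong
    ( Contains2413-∷⁻-min (All.map <⇒≤ y<M)
    ∘ Contains2413-∷∷⁻ (n<1+n y) x<M
    ∘ Contains2413-snoc⁻-min (m<n⇒m≤1+n (n<1+n y) ∷ n≤1+n y ∷ All.map m<n⇒m≤1+n y<M)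
    ∘ Contains2413-snoc⁻-min (n≤1+n x ∷ ≤-refl ∷ All.∷ʳ⁺ (All.map m<n⇒m≤1+n x<M) ≤-refl))
    (Contains2413-⊆ (x ∷ʳ y ∷ʳ ++⁺ʳ [ x ] (++⁺ʳ [ y ] ⊆-refl))))
  where
  x = suc y
  x<M : All (x <_) (mirror τ)
  x<M = All-mirror⁺ x<τ
  y<M : All (y <_) (mirror τ)
  y<M = All.map (<-trans (n<1+n y)) x<M

contains-mirror-∷∷-max : ∀ {x τ} → All (_< x) τ →
                         contains (mirror (x ∷ suc x ∷ τ)) p2413 ≡ contains (mirror τ) p2413
contains-mirror-∷∷-max {x} {τ} τ<x = trans (cong (λ w → contains w p2413) (mirror-∷∷ x y τ))
  (contains-2413-cong
    ( Contains2413-snoc⁻-max M≤y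
    ∘ Contains2413-snoc-snoc⁻ (n<1+n x) M<x
    ∘ Contains2413-∷⁻-max (All.map m≤n⇒m≤1+n rest≤y)
    ∘ Contains2413-∷⁻-max (≤-refl ∷ rest≤y))
    (Contains2413-⊆ (x ∷ʳ y ∷ʳ ++⁺ʳ [ x ] (++⁺ʳ [ y ] ⊆-refl))))
  where
  y = suc x
  M<x : All (_< x) (mirror τ)
  M<x = All-mirror⁺ τ<x
  M≤y : All (_≤ y) (mirror τ)
  M≤y = All.map m<n⇒m≤1+n M<x
  rest≤y : All (_≤ y) ((mirror τ ++ [ y ]) ++ [ x ])
  rest≤y = All.∷ʳ⁺ (All.∷ʳ⁺ M≤y ≤-refl) (n≤1+n x)

contains-mirror-map-suc : ∀ π → contains (mirror (map suc π)) p2413 ≡ contains (mirror π) p2413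
contains-mirror-map-suc π = trans (cong (λ w → contains w p2413) (mirror-map suc π))
  (contains-2413-cong (Contains2413-map⁻ s<s⁻¹ (mirror π)) (Contains2413-map⁺ s≤s))

module _ {x b : ℕ} {w : List ℕ} where

  mirror-∷∷-ascent⇒2413 : ∀ {s y} → x < b → s < x → s ∈ w → x < y → y ≢ b → y ∈ w →
                          Contains2413 (mirror (x ∷ b ∷ w))
  mirror-∷∷-ascent⇒2413 {s} {y} x<b s<x s∈w x<y y≢b y∈w =
    subst Contains2413 (sym (mirror-∷∷ x b w)) occ
    where
    occ : Contains2413 (x ∷ b ∷ ((mirror w ++ [ b ]) ++ [ x ]))
    occ with <-cmp b y
    ... | tri< b<y _ _ = occurrence (refl ∷ b ∷ʳ ++⁺ (++⁺ (mirror-pair y∈w s∈w) (refl ∷ [])) (x ∷ʳ []))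
                                    s<x x<b b<y
    ... | tri≈ _ b≡y _ = ⊥-elim (y≢b (sym b≡y))
    ... | tri> _ _ y<b = occurrence (refl ∷ refl ∷ ++⁺ʳ [ x ] (++⁺ʳ [ b ] (mirror-pair s∈w y∈w)))
                                    s<x x<y y<b

  mirror-∷∷-descent⇒2413 : ∀ {t y} → b < x → x < t → t ∈ w → y < x → y ≢ b → y ∈ w →
                           Contains2413 (mirror (x ∷ b ∷ w))
  mirror-∷∷-descent⇒2413 {t} {y} b<x x<t t∈w y<x y≢b y∈w =
    subst Contains2413 (sym (mirror-∷∷ x b w)) occ
    where
    occ : Contains2413 (x ∷ b ∷ ((mirror w ++ [ b ]) ++ [ x ]))
    occ with <-cmp b y
    ... | tri< b<y _ _ = occurrence (x ∷ʳ b ∷ʳ ++⁺ (++⁺ (mirror-pair y∈w t∈w) (refl ∷ [])) (refl ∷ []))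
                                    b<y y<x x<t
    ... | tri≈ _ b≡y _ = ⊥-elim (y≢b (sym b≡y))
    ... | tri> _ _ y<b = occurrence (x ∷ʳ refl ∷ ++⁺ (++⁺ʳ [ b ] (mirror-pair t∈w y∈w)) (refl ∷ []))
                                    y<b b<x x<t

⊆-pair : ∀ {x y : A} {xs} → x ∈ xs → y ∈ xs → x ≢ y → x ∷ y ∷ [] ⊆ xs ⊎ y ∷ x ∷ [] ⊆ xs
⊆-pair (here refl)  (here refl)  x≢y = ⊥-elim (x≢y refl)
⊆-pair (here refl)  (there y∈xs) _   = inj₁ (refl ∷ from∈ y∈xs)
⊆-pair (there x∈xs) (here refl)  _   = inj₂ (refl ∷ from∈ x∈xs)
⊆-pair {xs = z ∷ _} (there x∈xs) (there y∈xs) x≢y with ⊆-pair x∈xs y∈xs x≢y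
... | inj₁ s = inj₁ (z ∷ʳ s)
... | inj₂ s = inj₂ (z ∷ʳ s)

mirror-∷-middle⇒2413 : ∀ {a τ s₁ s₂ l₁ l₂} → s₁ < s₂ → s₂ < a → a < l₁ → l₁ < l₂ →
                       s₁ ∈ τ → s₂ ∈ τ → l₁ ∈ τ → l₂ ∈ τ → Contains2413 (mirror (a ∷ τ))
mirror-∷-middle⇒2413 {a} {τ} s₁<s₂ s₂<a a<l₁ l₁<l₂ s₁∈τ s₂∈τ l₁∈τ l₂∈τ =
  subst Contains2413 (sym (mirror-∷ a τ)) occ
  where
  occ : Contains2413 (a ∷ (mirror τ ++ [ a ]))
  occ with ⊆-pair s₁∈τ l₂∈τ (<⇒≢ (<-trans (<-trans s₁<s₂ s₂<a) (<-trans a<l₁ l₁<l₂)))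
  ... | inj₁ s₁l₂ = occurrence (a ∷ʳ ++⁺ (++⁺ (from∈ s₂∈τ) (reverse⁺ s₁l₂)) (refl ∷ []))
                               s₁<s₂ s₂<a (<-trans a<l₁ l₁<l₂)
  ... | inj₂ l₂s₁ = occurrence (refl ∷ ++⁺ʳ [ a ] (++⁺ l₂s₁ (from∈ (Any.reverse⁺ l₁∈τ))))
                               (<-trans s₁<s₂ s₂<a) a<l₁ l₁<l₂

-- Permutations as words

alphabet : ℕ → List ℕ
alphabet n = applyUpTo suc n

∈-alphabet⁺ : ∀ {v n} → 0 < v → v ≤ n → v ∈ alphabet n
∈-alphabet⁺ {suc i} _ i<n = ∈-applyUpTo⁺ suc i<n

∈-alphabet⁻ : ∀ {v n} → v ∈ alphabet n → 0 < v × v ≤ n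
∈-alphabet⁻ v∈ with _ , i<n , refl ← ∈-applyUpTo⁻ suc v∈ = z<s , i<n

alphabet-∷ʳ : ∀ n → alphabet n ++ [ suc n ] ≡ alphabet (suc n)
alphabet-∷ʳ = applyUpTo-∷ʳ suc

∷-∈-words : ∀ n k {a w} → a ∈ alphabet n → w ∈ words n k → a ∷ w ∈ words n (suc k)
∷-∈-words n k a∈ w∈ =
  ∈-concatMap⁺ (λ a → map (a ∷_) (words n k)) {alphabet n} (Any.map (λ { refl → ∈-map⁺ _ w∈ }) a∈)

∈-words⁻ : ∀ {n k w} → w ∈ words n k → length w ≡ k × All (_∈ alphabet n) w
∈-words⁻ {k = zero}  (here refl) = refl , []
∈-words⁻ {n} {suc k} w∈
  with _ , a∈ , aw∈ ← find (∈-concatMap⁻ (λ a → map (a ∷_) (words n k)) {alphabet n} w∈)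
  with _ , v∈ , refl ← ∈-map⁻ _ aw∈
  with len , v⊆ ← ∈-words⁻ v∈ = cong suc len , a∈ ∷ v⊆

words-bounds : ∀ n k {w} → w ∈ words n k → All (λ a → 0 < a × a ≤ n) w
words-bounds n k w∈ = All.map ∈-alphabet⁻ (proj₂ (∈-words⁻ {n} {k} w∈))

==-reflects : ∀ m n → Reflects (m ≡ n) (m == n)
==-reflects zero    zero    = ofʸ refl
==-reflects zero    (suc n) = ofⁿ λ ()
==-reflects (suc m) zero    = ofⁿ λ ()
==-reflects (suc m) (suc n) with m == n | ==-reflects m n
... | true  | ofʸ refl = ofʸ refl
... | false | ofⁿ m≢n  = ofⁿ (m≢n ∘ suc-injective)

distinct-∷⁻ : ∀ {x xs} → T (distinct (x ∷ xs)) → x ∉ xs × T (distinct xs)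
distinct-∷⁻ {x} {xs} d with fresh , d′ ← Equivalence.to T-∧ d = x∉xs , d′
  where
  x∉xs : x ∉ xs
  x∉xs x∈xs with x == x | ==-reflects x x | All.lookup (All.all⁺ (λ y → not (x == y)) xs fresh) x∈xs
  ... | false | ofⁿ x≢x | _ = x≢x refl

distinct-∷ : ∀ x {w} → All (x ≢_) w → distinct (x ∷ w) ≡ distinct w
distinct-∷ x {w} x∉w =
  cong (_∧ distinct w) (Equivalence.to T-≡ (All.all⁻ (λ y → not (x == y)) (All.map fresh x∉w)))
  where
  fresh : ∀ {y} → x ≢ y → T (not (x == y))
  fresh {y} x≢y with x == y | ==-reflects x y
  ... | false | _       = _
  ... | true  | ofʸ x≡y = x≢y x≡y

distinct-map-suc : ∀ w → distinct (map suc w) ≡ distinct w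
distinct-map-suc []      = refl
distinct-map-suc (x ∷ w) = cong₂ _∧_ (cong and (sym (map-∘ w))) (distinct-map-suc w)

distinct-++⁻ʳ : ∀ u {w} → T (distinct (u ++ w)) → T (distinct w)
distinct-++⁻ʳ []      d = d
distinct-++⁻ʳ (x ∷ u) {w} d = distinct-++⁻ʳ u (proj₂ (distinct-∷⁻ {x} {u ++ w} d))

distinct-length-≤ : ∀ {xs ys} → T (distinct xs) → All (_∈ ys) xs → length xs ≤ length ys
distinct-length-< : ∀ {xs ys v} → T (distinct xs) → All (_∈ ys) xs → v ∈ ys → v ∉ xs →
                    length xs < length ys

distinct-length-≤ {[]}     _ _ = z≤n
distinct-length-≤ {x ∷ xs} d (x∈ys ∷ xs⊆ys) with x∉xs , d′ ← distinct-∷⁻ d =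
  distinct-length-< d′ xs⊆ys x∈ys x∉xs

distinct-length-< {xs} {ys} {v} d xs⊆ys v∈ys v∉xs =
  ≤-<-trans (distinct-length-≤ d (All.tabulate xs⊆ys∖v))
            (filter-notAll (¬? ∘ (v ≟_)) ys (Any.map (λ v≡y v≢y → v≢y v≡y) v∈ys))
  where
  xs⊆ys∖v : ∀ {y} → y ∈ xs → y ∈ filter (¬? ∘ (v ≟_)) ys
  xs⊆ys∖v y∈xs = ∈-filter⁺ (¬? ∘ (v ≟_)) (All.lookup xs⊆ys y∈xs) λ { refl → v∉xs y∈xs }

distinct-covers : ∀ {xs ys} → T (distinct xs) → All (_∈ ys) xs → length ys ≤ length xs →
                  ∀ {v} → v ∈ ys → v ∈ xs
distinct-covers {xs} d xs⊆ys ys≤xs {v} v∈ys with v ∈? xs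
... | yes v∈xs = v∈xs
... | no  v∉xs = ⊥-elim (<⇒≱ (distinct-length-< d xs⊆ys v∈ys v∉xs) ys≤xs)

permutation-∋ : ∀ {n π v} → π ∈ words n n → T (distinct π) → v ∈ alphabet n → v ∈ π
permutation-∋ {n} π∈ d with len , π⊆ ← ∈-words⁻ π∈ =
  distinct-covers d π⊆ (≤-reflexive (trans (length-applyUpTo suc n) (sym len)))

permutation-suffix-∋ : ∀ u {n w v} → u ++ w ∈ words n n → T (distinct (u ++ w)) →
                       0 < v → v ≤ n → All (v ≢_) u → v ∈ w
permutation-suffix-∋ u π∈ d 0<v v≤n v∉u with ∈-++⁻ u (permutation-∋ π∈ d (∈-alphabet⁺ 0<v v≤n))
... | inj₁ v∈u = ⊥-elim (All.lookup v∉u v∈u refl)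
... | inj₂ v∈w = v∈w

-- Counting

count : (A → Bool) → List A → ℕ
count P xs = length (filterᵇ P xs)

count-cong : ∀ {P Q : A → Bool} xs → (∀ {x} → x ∈ xs → P x ≡ Q x) → count P xs ≡ count Q xs
count-cong {P = P} {Q = Q} []       _   = refl
count-cong {P = P} {Q = Q} (x ∷ xs) P≡Q with P x | Q x | P≡Q (here refl)
... | true  | true  | _ = cong suc (count-cong xs (P≡Q ∘ there))
... | false | false | _ = count-cong xs (P≡Q ∘ there)

count-none : ∀ {P : A → Bool} xs → (∀ {x} → x ∈ xs → ¬ T (P x)) → count P xs ≡ 0
count-none {P = P} []       _  = refl
count-none {P = P} (x ∷ xs) ¬P with P x | ¬P (here refl)
... | false | _   = count-none xs (¬P ∘ there)
... | true  | ¬tt = ⊥-elim (¬tt _)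

count-++ : ∀ (P : A → Bool) xs ys → count P (xs ++ ys) ≡ count P xs + count P ys
count-++ P []       ys = refl
count-++ P (x ∷ xs) ys with P x
... | true  = cong suc (count-++ P xs ys)
... | false = count-++ P xs ys

count-filterᵇ : ∀ (P Q : A → Bool) xs → count P (filterᵇ Q xs) ≡ count (λ x → Q x ∧ P x) xs
count-filterᵇ P Q []       = refl
count-filterᵇ P Q (x ∷ xs) with Q x
... | false = count-filterᵇ P Q xs
... | true with P x
...   | true  = cong suc (count-filterᵇ P Q xs)
...   | false = count-filterᵇ P Q xs

count-map : ∀ (P : B → Bool) (f : A → B) xs → count P (map f xs) ≡ count (P ∘ f) xs
count-map P f []       = refl
count-map P f (x ∷ xs) with P (f x)
... | true  = cong suc (count-map P f xs)
... | false = count-map P f xs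

count-concatMap : ∀ (P : B → Bool) (f : A → List B) xs →
                  count P (concatMap f xs) ≡ sum (map (count P ∘ f) xs)
count-concatMap P f []       = refl
count-concatMap P f (x ∷ xs) =
  trans (count-++ P (f x) (concatMap f xs)) (cong (count P (f x) +_) (count-concatMap P f xs))

sum-map-∷ʳ : ∀ (g : A → ℕ) xs y → sum (map g (xs ++ [ y ])) ≡ sum (map g xs) + g y
sum-map-∷ʳ g xs y = begin
  sum (map g (xs ++ [ y ]))   ≡⟨ cong sum (map-++ g xs [ y ]) ⟩
  sum (map g xs ++ [ g y ])   ≡⟨ sum-++ (map g xs) [ g y ] ⟩
  sum (map g xs) + (g y + 0)  ≡⟨ cong (sum (map g xs) +_) (+-identityʳ (g y)) ⟩
  sum (map g xs) + g y        ∎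
  where open ≡-Reasoning

sum-map-none : ∀ (g : A → ℕ) xs → (∀ {x} → x ∈ xs → g x ≡ 0) → sum (map g xs) ≡ 0
sum-map-none g []       _   = refl
sum-map-none g (x ∷ xs) g≡0 = cong₂ _+_ (g≡0 (here refl)) (sum-map-none g xs (g≡0 ∘ there))

count-words-suc : ∀ P n k →
  count P (words n (suc k)) ≡ sum (map (λ a → count (P ∘ (a ∷_)) (words n k)) (alphabet n))
count-words-suc P n k = begin
  count P (concatMap (λ a → map (a ∷_) (words n k)) (alphabet n))
    ≡⟨ count-concatMap P (λ a → map (a ∷_) (words n k)) (alphabet n) ⟩
  sum (map (λ a → count P (map (a ∷_) (words n k))) (alphabet n))
    ≡⟨ cong sum (map-cong (λ a → count-map P (a ∷_) (words n k)) (alphabet n)) ⟩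
  sum (map (λ a → count (P ∘ (a ∷_)) (words n k)) (alphabet n)) ∎
  where open ≡-Reasoning

-- Words over [1..m+1] avoiding the letter 1 are exactly the shifts of the words over [1..m].
count-words-without-1 : ∀ P m k → (∀ {w} → 1 ∈ w → ¬ T (P w)) →
                        count P (words (suc m) k) ≡ count (P ∘ map suc) (words m k)
count-words-without-1 P m zero    _  =
  count-cong {P = P} {Q = P ∘ map suc} ([] ∷ []) λ { (here refl) → refl }
count-words-without-1 P m (suc k) 1∉ = begin
  count P (words (suc m) (suc k))
    ≡⟨ count-words-suc P (suc m) k ⟩
  g 1 + sum (map g (applyUpTo (suc ∘ suc) m))
    ≡⟨ cong₂ _+_ (count-none (words (suc m) k) λ _ → 1∉ (here refl))
                 (cong sum (trans (map-applyUpTo (suc ∘ suc) g m)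
                                  (sym (map-applyUpTo suc (g ∘ suc) m)))) ⟩
  sum (map (g ∘ suc) (alphabet m))
    ≡⟨ cong sum (map-cong (λ a → count-words-without-1 (P ∘ (suc a ∷_)) m k (1∉ ∘ there)) (alphabet m)) ⟩
  sum (map (λ a → count ((P ∘ map suc) ∘ (a ∷_)) (words m k)) (alphabet m))
    ≡⟨ count-words-suc (P ∘ map suc) m k ⟨
  count (P ∘ map suc) (words m (suc k)) ∎
  where
  open ≡-Reasoning
  g : ℕ → ℕ
  g a = count (P ∘ (a ∷_)) (words (suc m) k)

count-words-without-max : ∀ P m k → (∀ {w} → suc m ∈ w → ¬ T (P w)) →
                          count P (words (suc m) k) ≡ count P (words m k)
count-words-without-max P m zero    _    = refl
count-words-without-max P m (suc k) m+1∉ = begin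
  count P (words (suc m) (suc k))
    ≡⟨ count-words-suc P (suc m) k ⟩
  sum (map g (alphabet (suc m)))
    ≡⟨ cong (sum ∘ map g) (alphabet-∷ʳ m) ⟨
  sum (map g (alphabet m ++ [ suc m ]))
    ≡⟨ sum-map-∷ʳ g (alphabet m) (suc m) ⟩
  sum (map g (alphabet m)) + g (suc m)
    ≡⟨ cong (sum (map g (alphabet m)) +_) (count-none (words (suc m) k) λ _ → m+1∉ (here refl)) ⟩
  sum (map g (alphabet m)) + 0
    ≡⟨ +-identityʳ _ ⟩
  sum (map g (alphabet m))
    ≡⟨ cong sum (map-cong (λ a → count-words-without-max (P ∘ (a ∷_)) m k (m+1∉ ∘ there)) (alphabet m)) ⟩
  sum (map (λ a → count (P ∘ (a ∷_)) (words m k)) (alphabet m))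
    ≡⟨ count-words-suc P m k ⟨
  count P (words m (suc k)) ∎
  where
  open ≡-Reasoning
  g : ℕ → ℕ
  g a = count (P ∘ (a ∷_)) (words (suc m) k)

-- The recurrence

mirrorAvoider : List ℕ → Bool
mirrorAvoider π = distinct π ∧ avoids (mirror π) p2413

r≡count : ∀ n → r n p2413 ≡ count mirrorAvoider (words n n)
r≡count n = trans (count-map (λ w → avoids w p2413) mirror (S n))
                  (count-filterᵇ (λ π → avoids (mirror π) p2413) distinct (words n n))

mirrorAvoider⁻ : ∀ {π} → T (mirrorAvoider π) → T (distinct π) × ¬ Contains2413 (mirror π)
mirrorAvoider⁻ {π} t with d , avoid ← Equivalence.to T-∧ t =
  d , T-not⇒¬T avoid ∘ Equivalence.from (contains-2413⇔ (mirror π))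
  where
  T-not⇒¬T : ∀ {b} → T (not b) → ¬ T b
  T-not⇒¬T {false} _ ()

mirrorAvoider-dup : ∀ u {x w} → x ∈ w → ¬ T (mirrorAvoider (u ++ x ∷ w))
mirrorAvoider-dup u {x} {w} x∈w t =
  proj₁ (distinct-∷⁻ {x} {w} (distinct-++⁻ʳ u (proj₁ (mirrorAvoider⁻ {u ++ x ∷ w} t)))) x∈w

¬mirrorAvoider : ∀ π → (T (distinct π) → Contains2413 (mirror π)) → ¬ T (mirrorAvoider π)
¬mirrorAvoider π forced t with d , ¬occ ← mirrorAvoider⁻ {π} t = ¬occ (forced d)

mirrorAvoider-cong : ∀ π σ → distinct π ≡ distinct σ →
                     contains (mirror π) p2413 ≡ contains (mirror σ) p2413 →
                     mirrorAvoider π ≡ mirrorAvoider σ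
mirrorAvoider-cong _ _ = cong₂ (λ d c → d ∧ not c)

mirrorAvoider-map-suc : ∀ v → mirrorAvoider (map suc v) ≡ mirrorAvoider v
mirrorAvoider-map-suc v =
  mirrorAvoider-cong (map suc v) v (distinct-map-suc v) (contains-mirror-map-suc v)

mirrorAvoider-∷-min : ∀ {x v} → All (x <_) v → mirrorAvoider (x ∷ v) ≡ mirrorAvoider v
mirrorAvoider-∷-min {x} {v} x<v = mirrorAvoider-cong (x ∷ v) v
  (distinct-∷ x (All.map <⇒≢ x<v)) (contains-mirror-∷-min (All.map <⇒≤ x<v))

mirrorAvoider-∷-max : ∀ {x v} → All (_< x) v → mirrorAvoider (x ∷ v) ≡ mirrorAvoider v
mirrorAvoider-∷-max {x} {v} v<x = mirrorAvoider-cong (x ∷ v) v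
  (distinct-∷ x (All.map >⇒≢ v<x)) (contains-mirror-∷-max (All.map <⇒≤ v<x))

mirrorAvoider-∷∷-min : ∀ {y v} → All (suc y <_) v → mirrorAvoider (suc y ∷ y ∷ v) ≡ mirrorAvoider v
mirrorAvoider-∷∷-min {y} {v} x<v = mirrorAvoider-cong (suc y ∷ y ∷ v) v
  (trans (distinct-∷ (suc y) (>⇒≢ (n<1+n y) ∷ All.map <⇒≢ x<v))
         (distinct-∷ y (All.map (<⇒≢ ∘ <-trans (n<1+n y)) x<v)))
  (contains-mirror-∷∷-min x<v)

mirrorAvoider-∷∷-max : ∀ {x v} → All (_< x) v → mirrorAvoider (x ∷ suc x ∷ v) ≡ mirrorAvoider v
mirrorAvoider-∷∷-max {x} {v} v<x = mirrorAvoider-cong (x ∷ suc x ∷ v) v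
  (trans (distinct-∷ x (<⇒≢ (n<1+n x) ∷ All.map >⇒≢ v<x))
         (distinct-∷ (suc x) (All.map (λ a<x → >⇒≢ (<-trans a<x (n<1+n x))) v<x)))
  (contains-mirror-∷∷-max v<x)

module _ {k b w} (π∈ : 2 ∷ b ∷ w ∈ words (4 + k) (4 + k)) (d : T (distinct (2 ∷ b ∷ w))) where

  private
    letter : ∀ {v} → 0 < v → v ≤ 4 + k → v ≢ 2 → v ≢ b → v ∈ w
    letter 0<v v≤n v≢2 v≢b = permutation-suffix-∋ (2 ∷ b ∷ []) π∈ d 0<v v≤n (v≢2 ∷ v≢b ∷ [])

  mirror-2∷ascent⇒2413 : 3 ≤ b → Contains2413 (mirror (2 ∷ b ∷ w))
  mirror-2∷ascent⇒2413 3≤b with b ≟ 3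
  ... | yes refl = mirror-∷∷-ascent⇒2413 3≤b ≤-refl (letter z<s (s≤s z≤n) (λ ()) (λ ()))
                     (n≤1+n 3) (λ ()) (letter z<s (s≤s (s≤s (s≤s (s≤s z≤n)))) (λ ()) (λ ()))
  ... | no b≢3   = mirror-∷∷-ascent⇒2413 3≤b ≤-refl
                     (letter z<s (s≤s z≤n) (λ ()) (<⇒≢ (≤-trans (s≤s (s≤s z≤n)) 3≤b)))
                     ≤-refl (b≢3 ∘ sym) (letter z<s (s≤s (s≤s (s≤s z≤n))) (λ ()) (b≢3 ∘ sym))

module _ {k b w} (π∈ : 3 + k ∷ b ∷ w ∈ words (4 + k) (4 + k)) (d : T (distinct (3 + k ∷ b ∷ w))) where

  private
    letter : ∀ {v} → 0 < v → v ≤ 4 + k → v ≢ 3 + k → v ≢ b → v ∈ w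
    letter 0<v v≤n v≢x v≢b = permutation-suffix-∋ (3 + k ∷ b ∷ []) π∈ d 0<v v≤n (v≢x ∷ v≢b ∷ [])

    max∈w : b < 3 + k → 4 + k ∈ w
    max∈w b<x = letter z<s ≤-refl (>⇒≢ (n<1+n _)) (>⇒≢ (<-trans b<x (n<1+n _)))

  mirror-penultimate∷descent⇒2413 : b < 3 + k → Contains2413 (mirror (3 + k ∷ b ∷ w))
  mirror-penultimate∷descent⇒2413 b<x with b ≟ 2 + k
  ... | yes refl = mirror-∷∷-descent⇒2413 b<x ≤-refl (max∈w b<x) (<-trans (n<1+n _) (n<1+n _))
                     (<⇒≢ (n<1+n _))
                     (letter z<s (m≤n⇒m≤1+n (m≤n⇒m≤1+n (n≤1+n _)))
                             (<⇒≢ (<-trans (n<1+n _) (n<1+n _))) (<⇒≢ (n<1+n _)))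
  ... | no b≢y   = mirror-∷∷-descent⇒2413 b<x ≤-refl (max∈w b<x) ≤-refl (b≢y ∘ sym)
                     (letter z<s (m≤n⇒m≤1+n (n≤1+n _)) (<⇒≢ (n<1+n _)) (b≢y ∘ sym))

mirror-middle⇒2413 : ∀ {k a w} → 3 ≤ a → a < 3 + k → a ∷ w ∈ words (4 + k) (4 + k) →
                     T (distinct (a ∷ w)) → Contains2413 (mirror (a ∷ w))
mirror-middle⇒2413 {k} {a} {w} 3≤a a<x π∈ d =
  mirror-∷-middle⇒2413 ≤-refl 3≤a a<x ≤-refl
    (letter z<s (s≤s z≤n) (<⇒≢ (≤-trans (s≤s (s≤s z≤n)) 3≤a)))
    (letter z<s (s≤s (s≤s z≤n)) (<⇒≢ 3≤a))
    (letter z<s (n≤1+n _) (>⇒≢ a<x))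
    (letter z<s ≤-refl (>⇒≢ (<-trans a<x (n<1+n _))))
  where
  letter : ∀ {v} → 0 < v → v ≤ 4 + k → v ≢ a → v ∈ w
  letter 0<v v≤n v≢a = permutation-suffix-∋ [ a ] π∈ d 0<v v≤n (v≢a ∷ [])

count-head-1 : ∀ m →
  count (mirrorAvoider ∘ (1 ∷_)) (words (suc m) m) ≡ count mirrorAvoider (words m m)
count-head-1 m = begin
  count (mirrorAvoider ∘ (1 ∷_)) (words (suc m) m)
    ≡⟨ count-words-without-1 _ m m (mirrorAvoider-dup []) ⟩
  count (mirrorAvoider ∘ (1 ∷_) ∘ map suc) (words m m)
    ≡⟨ count-cong (words m m) (λ {v} v∈ → trans
         (mirrorAvoider-∷-min (All.map⁺ (All.map (s≤s ∘ proj₁) (words-bounds m m v∈))))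
         (mirrorAvoider-map-suc v)) ⟩
  count mirrorAvoider (words m m) ∎
  where open ≡-Reasoning

count-head-max : ∀ m →
  count (mirrorAvoider ∘ (suc m ∷_)) (words (suc m) m) ≡ count mirrorAvoider (words m m)
count-head-max m = begin
  count (mirrorAvoider ∘ (suc m ∷_)) (words (suc m) m)
    ≡⟨ count-words-without-max _ m m (mirrorAvoider-dup []) ⟩
  count (mirrorAvoider ∘ (suc m ∷_)) (words m m)
    ≡⟨ count-cong (words m m)
         (λ v∈ → mirrorAvoider-∷-max (All.map (s≤s ∘ proj₂) (words-bounds m m v∈))) ⟩
  count mirrorAvoider (words m m) ∎
  where open ≡-Reasoning

count-head-2 : ∀ k → count (mirrorAvoider ∘ (2 ∷_)) (words (4 + k) (3 + k)) ≡
                     count mirrorAvoider (words (2 + k) (2 + k))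
count-head-2 k = begin
  count P (words (4 + k) (3 + k))
    ≡⟨ count-words-suc P (4 + k) (2 + k) ⟩
  g 1 + (g 2 + sum (map g (applyUpTo (3 +_) (2 + k))))
    ≡⟨ cong₂ (λ x y → g 1 + (x + y)) (count-none W (λ _ ())) (sum-map-none g _ ascent≡0) ⟩
  g 1 + 0
    ≡⟨ +-identityʳ _ ⟩
  count (P ∘ (1 ∷_)) (words (4 + k) (2 + k))
    ≡⟨ count-words-without-1 _ (3 + k) (2 + k) (mirrorAvoider-dup [ 2 ]) ⟩
  count (P ∘ (1 ∷_) ∘ map suc) (words (3 + k) (2 + k))
    ≡⟨ count-words-without-1 _ (2 + k) (2 + k) (mirrorAvoider-dup [] ∘ there ∘ ∈-map⁺ suc) ⟩
  count (P ∘ (1 ∷_) ∘ map suc ∘ map suc) (words (2 + k) (2 + k))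
    ≡⟨ count-cong (words (2 + k) (2 + k)) (λ {u} u∈ → trans
         (mirrorAvoider-∷∷-min
           (All.map⁺ (All.map⁺ (All.map (s≤s ∘ s≤s ∘ proj₁) (words-bounds (2 + k) (2 + k) u∈)))))
         (trans (mirrorAvoider-map-suc (map suc u)) (mirrorAvoider-map-suc u))) ⟩
  count mirrorAvoider (words (2 + k) (2 + k)) ∎
  where
  open ≡-Reasoning
  P = mirrorAvoider ∘ (2 ∷_)
  W = words (4 + k) (2 + k)
  g : ℕ → ℕ
  g b = count (P ∘ (b ∷_)) W
  ascent≡0 : ∀ {b} → b ∈ applyUpTo (3 +_) (2 + k) → g b ≡ 0
  ascent≡0 {b} b∈ with _ , _ , refl ← ∈-applyUpTo⁻ (3 +_) b∈ = count-none W λ {w} w∈ →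
    ¬mirrorAvoider (2 ∷ b ∷ w) λ d → mirror-2∷ascent⇒2413 {k} {b} {w}
      (∷-∈-words (4 + k) (3 + k) (there (here refl)) (∷-∈-words (4 + k) (2 + k) (there (there b∈)) w∈)) d
      (s≤s (s≤s (s≤s z≤n)))

count-head-penultimate : ∀ k → count (mirrorAvoider ∘ (3 + k ∷_)) (words (4 + k) (3 + k)) ≡
                               count mirrorAvoider (words (2 + k) (2 + k))
count-head-penultimate k = begin
  count P (words (4 + k) (3 + k))
    ≡⟨ count-words-suc P (4 + k) (2 + k) ⟩
  sum (map g (alphabet (4 + k)))
    ≡⟨ cong (sum ∘ map g) (trans (cong (_++ [ 4 + k ]) (alphabet-∷ʳ (2 + k))) (alphabet-∷ʳ (3 + k))) ⟨
  sum (map g ((alphabet (2 + k) ++ [ 3 + k ]) ++ [ 4 + k ]))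
    ≡⟨ trans (sum-map-∷ʳ g (alphabet (2 + k) ++ [ 3 + k ]) (4 + k))
             (cong (_+ g (4 + k)) (sum-map-∷ʳ g (alphabet (2 + k)) (3 + k))) ⟩
  (sum (map g (alphabet (2 + k))) + g (3 + k)) + g (4 + k)
    ≡⟨ cong (_+ g (4 + k)) (cong₂ _+_ (sum-map-none g _ descent≡0) (count-none W repeat)) ⟩
  count (P ∘ (4 + k ∷_)) (words (4 + k) (2 + k))
    ≡⟨ count-words-without-max _ (3 + k) (2 + k) (mirrorAvoider-dup [ 3 + k ]) ⟩
  count (P ∘ (4 + k ∷_)) (words (3 + k) (2 + k))
    ≡⟨ count-words-without-max _ (2 + k) (2 + k) (mirrorAvoider-dup [] ∘ there) ⟩
  count (P ∘ (4 + k ∷_)) (words (2 + k) (2 + k))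
    ≡⟨ count-cong (words (2 + k) (2 + k))
         (λ u∈ → mirrorAvoider-∷∷-max (All.map (s≤s ∘ proj₂) (words-bounds (2 + k) (2 + k) u∈))) ⟩
  count mirrorAvoider (words (2 + k) (2 + k)) ∎
  where
  open ≡-Reasoning
  P = mirrorAvoider ∘ (3 + k ∷_)
  W = words (4 + k) (2 + k)
  g : ℕ → ℕ
  g b = count (P ∘ (b ∷_)) W
  repeat : ∀ {w} → w ∈ W → ¬ T (P (3 + k ∷ w))
  repeat {w} _ = mirrorAvoider-dup [] {3 + k} {3 + k ∷ w} (here refl)
  descent≡0 : ∀ {b} → b ∈ alphabet (2 + k) → g b ≡ 0
  descent≡0 {b} b∈ with 0<b , b≤ ← ∈-alphabet⁻ b∈ = count-none W λ {w} w∈ →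
    ¬mirrorAvoider (3 + k ∷ b ∷ w) λ d → mirror-penultimate∷descent⇒2413 {k} {b} {w}
      (∷-∈-words (4 + k) (3 + k) (∈-alphabet⁺ z<s (n≤1+n _))
        (∷-∈-words (4 + k) (2 + k) (∈-alphabet⁺ 0<b (≤-trans b≤ (≤-trans (n≤1+n _) (n≤1+n _)))) w∈)) d
      (s≤s b≤)

count-head-middle≡0 : ∀ k →
  sum (map (λ a → count (mirrorAvoider ∘ (a ∷_)) (words (4 + k) (3 + k))) (applyUpTo (3 +_) k)) ≡ 0
count-head-middle≡0 k = sum-map-none _ _ λ {a} a∈ → count-none _ λ {w} w∈ →
  ¬mirrorAvoider (a ∷ w) (mirror-middle⇒2413 (3≤a a∈) (a<x a∈) (∷-∈-words (4 + k) (3 + k) (a∈alphabet a∈) w∈))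
  where
  3≤a : ∀ {a} → a ∈ applyUpTo (3 +_) k → 3 ≤ a
  3≤a a∈ with _ , _ , refl ← ∈-applyUpTo⁻ (3 +_) a∈ = s≤s (s≤s (s≤s z≤n))
  a<x : ∀ {a} → a ∈ applyUpTo (3 +_) k → a < 3 + k
  a<x a∈ with _ , i<k , refl ← ∈-applyUpTo⁻ (3 +_) a∈ = s≤s (s≤s (s≤s i<k))
  a∈alphabet : ∀ {a} → a ∈ applyUpTo (3 +_) k → a ∈ alphabet (4 + k)
  a∈alphabet a∈ = ∈-alphabet⁺ (≤-trans (s≤s z≤n) (3≤a a∈)) (<⇒≤ (<-trans (a<x a∈) (n<1+n _)))

recurrence : ∀ k → r (4 + k) p2413 ≡ 2 * r (3 + k) p2413 + 2 * r (2 + k) p2413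
recurrence k = begin
  r (4 + k) p2413
    ≡⟨ r≡count (4 + k) ⟩
  count mirrorAvoider (words (4 + k) (4 + k))
    ≡⟨ count-words-suc mirrorAvoider (4 + k) (3 + k) ⟩
  g 1 + (g 2 + sum (map g (applyUpTo (3 +_) (2 + k))))
    ≡⟨ cong (λ as → g 1 + (g 2 + sum (map g as))) middle++ ⟨
  g 1 + (g 2 + sum (map g ((middle ++ [ 3 + k ]) ++ [ 4 + k ])))
    ≡⟨ cong (λ s → g 1 + (g 2 + s)) (trans (sum-map-∷ʳ g (middle ++ [ 3 + k ]) (4 + k))
                                           (cong (_+ g (4 + k)) (sum-map-∷ʳ g middle (3 + k)))) ⟩
  g 1 + (g 2 + ((sum (map g middle) + g (3 + k)) + g (4 + k)))
    ≡⟨ cong₂ _+_ (count-head-1 (3 + k))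
                 (cong₂ _+_ (count-head-2 k)
                            (cong₂ _+_ (cong₂ _+_ (count-head-middle≡0 k) (count-head-penultimate k))
                                       (count-head-max (3 + k)))) ⟩
  r₃ + (r₂ + (r₂ + r₃))
    ≡⟨ regroup r₃ r₂ ⟩
  2 * r₃ + 2 * r₂
    ≡⟨ cong₂ (λ x y → 2 * x + 2 * y) (r≡count (3 + k)) (r≡count (2 + k)) ⟨
  2 * r (3 + k) p2413 + 2 * r (2 + k) p2413 ∎
  where
  open ≡-Reasoning
  g : ℕ → ℕ
  g a = count (mirrorAvoider ∘ (a ∷_)) (words (4 + k) (3 + k))
  middle = applyUpTo (3 +_) k
  middle++ : (middle ++ [ 3 + k ]) ++ [ 4 + k ] ≡ applyUpTo (3 +_) (2 + k)
  middle++ = trans (cong (_++ [ 4 + k ]) (applyUpTo-∷ʳ (3 +_) k)) (applyUpTo-∷ʳ (3 +_) (suc k))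
  r₃ = count mirrorAvoider (words (3 + k) (3 + k))
  r₂ = count mirrorAvoider (words (2 + k) (2 + k))
  regroup : ∀ x y → x + (y + (y + x)) ≡ 2 * x + 2 * y
  regroup = solve-∀

theorem15 : (n : ℕ) → 3 ≤ n → r n p2413 ≡ 2 * r (n ∸ 1) p2413 + 2 * r (n ∸ 2) p2413
-- For n = 3 the first letters 2 and n − 1 coincide; this case is a direct computation.
theorem15 3                       _              = refl
theorem15 (suc (suc (suc (suc k)))) _            = recurrence k
theorem15 1                       (s≤s ())
theorem15 2                       (s≤s (s≤s ()))
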